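{- Let $\mathcal S$ be a TRS. If $\mathcal S$ is compatible with some strongly linear matrix interpretation $\mathcal A$, then $\mathcal S$ is compatible with some strongly linear interpretation $\mathcal B$.
   Context: A matrix interpretation $\mathcal A$ of dimension $k$ assigns to each $n$-ary symbol $f$ a map $f_{\mathcal A}:(\mathbb N^k)^n\to\mathbb N^k$ of the form $f_{\mathcal A}(\vec v_1,\dots,\vec v_n)=F_1\vec v_1+\dots+F_n\vec v_n+\vec f$; it is a strongly linear matrix interpretation if all $F_i$ are identity matrices. A strongly linear interpretation (SLI) is a one-dimensional one of this kind, i.e. $f_{\mathcal B}(x_1,\dots,x_n)=x_1+\dots+x_n+c_f$ with $c_f\in\mathbb N$. On $\mathbb N^k$, $\vec x>\vec y$ iff $x_1>y_1$ and $x_j\ge y_j$ for $j\ge2$. $\mathcal S$ is compatible with $\mathcal A$ if $[\alpha]_{\mathcal A}(l)>[\alpha]_{\mathcal A}(r)$ for every rule $l\to r\in\mathcal S$ and every assignment $\alpha$ of vectors to variables, where $[\alpha]_{\mathcal A}$ is the induced evaluation. -}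

module Defs where

open import Data.Nat using (ℕ; zero; suc; _+_; _*_; _>_; _≥_)
open import Data.Fin using (Fin)
open import Data.Vec using (Vec; []; _∷_; lookup; tabulate; map; zipWith; foldr; replicate; head; tail)
open import Data.Vec.Relation.Binary.Pointwise.Inductive using (Pointwise)
open import Data.List using (List)
open import Data.Product using (_×_; ∃)
open import Relation.Binary.PropositionalEquality using (_≡_)
open import Relation.Nullary using (¬_)

record Signature : Set₁ where
  field
    Sym   : Set
    arity : Sym → ℕ

module _ (Σ : Signature) where
  open Signature Σ

  Var : Set
  Var = ℕ

  data Term : Set where
    var : Var → Term
    fun : (f : Sym) → Vec Term (arity f) → Term

  mutual
    data _occursIn_ (x : Var) : Term → Set where
      here : x occursIn var x
      there : ∀ {f ts} → x occursInArgs ts → x occursIn fun f ts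

    data _occursInArgs_ (x : Var) : ∀ {n} → Vec Term n → Set where
      hd : ∀ {n t} {ts : Vec Term n} → x occursIn t → x occursInArgs (t ∷ ts)
      tl : ∀ {n t} {ts : Vec Term n} → x occursInArgs ts → x occursInArgs (t ∷ ts)

  IsVar : Term → Set
  IsVar t = ∃ λ x → t ≡ var x

  record TRS : Set₁ where
    field
      Rule      : Term → Term → Set
      lhs-nonvar : ∀ {l r} → Rule l r → ¬ IsVar l
      vars-ok   : ∀ {l r} → Rule l r → ∀ x → x occursIn r → x occursIn l

Matrix : ℕ → Set
Matrix k = Vec (Vec ℕ k) k

_+v_ : ∀ {k} → Vec ℕ k → Vec ℕ k → Vec ℕ k
_+v_ = zipWith _+_

dot : ∀ {k} → Vec ℕ k → Vec ℕ k → ℕ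
dot u v = foldr (λ _ → ℕ) _+_ 0 (zipWith _*_ u v)

_·v_ : ∀ {k} → Matrix k → Vec ℕ k → Vec ℕ k
M ·v v = map (λ row → dot row v) M

identity : ∀ k → Matrix k
identity k = tabulate λ i → tabulate λ j → δ i j
  where
  δ : ∀ {k} → Fin k → Fin k → ℕ
  δ Fin.zero Fin.zero = 1
  δ Fin.zero (Fin.suc j) = 0
  δ (Fin.suc i) Fin.zero = 0
  δ (Fin.suc i) (Fin.suc j) = δ i j

_>v_ : ∀ {k} → Vec ℕ (suc k) → Vec ℕ (suc k) → Set
x >v y = (head x > head y) × Pointwise _≥_ (tail x) (tail y)

-- Matrix interpretations of dimension k:
--   f_A(v₁,…,vₙ) = F₁ v₁ + … + Fₙ vₙ + f

module _ {Σ : Signature} where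
  open Signature Σ

  record MatrixInterpretation (k : ℕ) : Set where
    field
      mat   : (f : Sym) → Fin (arity f) → Matrix k
      const : Sym → Vec ℕ k

  StronglyLinearMI : ∀ {k} → MatrixInterpretation k → Set
  StronglyLinearMI {k} A =
    ∀ f i → MatrixInterpretation.mat A f i ≡ identity k

  module _ {k : ℕ} (A : MatrixInterpretation k) (α : Var Σ → Vec ℕ k) where
    open MatrixInterpretation A
    mutual
      evalMI : Term Σ → Vec ℕ k
      evalMI (var x) = α x
      evalMI (fun f ts) =
        foldr (λ _ → Vec ℕ k) _+v_ (const f)
              (zipWith _·v_ (tabulate (mat f)) (evalMIs ts))

      evalMIs : ∀ {n} → Vec (Term Σ) n → Vec (Vec ℕ k) n
      evalMIs [] = []
      evalMIs (t ∷ ts) = evalMI t ∷ evalMIs ts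

  CompatibleMI : ∀ {k} → TRS Σ → MatrixInterpretation (suc k) → Set
  CompatibleMI S A = ∀ {l r} → TRS.Rule S l r →
    ∀ (α : Var Σ → Vec ℕ _) → evalMI A α l >v evalMI A α r

  -- Strongly linear interpretations: f_B(x₁,…,xₙ) = x₁ + … + xₙ + c_f

  SLI : Set
  SLI = Sym → ℕ

  module _ (c : SLI) (β : Var Σ → ℕ) where
    mutual
      evalSLI : Term Σ → ℕ
      evalSLI (var x) = β x
      evalSLI (fun f ts) = sumArgs ts + c f

      sumArgs : ∀ {n} → Vec (Term Σ) n → ℕ
      sumArgs [] = 0
      sumArgs (t ∷ ts) = evalSLI t + sumArgs ts

  CompatibleSLI : TRS Σ → SLI → Set
  CompatibleSLI S c = ∀ {l r} → TRS.Rule S l r →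
    ∀ (β : Var Σ → ℕ) → evalSLI c β l > evalSLI c β r

-- Every coefficient matrix of A is the identity, so the first coordinate of
-- the value of a term is computed from the first coordinates of the constants
-- and of the assignment alone, by the strongly linear interpretation
-- c_f = head (const f).  Since >v compares first coordinates strictly,
-- compatibility of A at the assignment x ↦ β x ∷ 0 ∷ … ∷ 0 yields
-- compatibility of c at β.

module Submission where

open import Defs
open import Data.Nat using (ℕ; suc; _+_; _*_; _>_)
open import Data.Nat.Properties using (+-assoc; +-identityʳ; *-identityˡ)
open import Data.Product using (∃; _×_; _,_; proj₁)
open import Data.Fin using (Fin)
open import Data.Vec using (Vec; []; _∷_; head; tail; map; tabulate; replicate; foldr; zipWith)
open import Data.Vec.Properties using (tabulate-∘)
open import Relation.Binary.PropositionalEquality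
open ≡-Reasoning

dot-zeroˡ : ∀ {k} (v : Vec ℕ k) → dot (tabulate (λ (_ : Fin k) → 0)) v ≡ 0
dot-zeroˡ []      = refl
dot-zeroˡ (_ ∷ v) = dot-zeroˡ v

identity-·v : ∀ {k} (v : Vec ℕ k) → identity k ·v v ≡ v
identity-·v []               = refl
identity-·v {suc k} (x ∷ v) = cong₂ _∷_ first-row other-rows
  where
  first-row : 1 * x + dot (tabulate (λ (_ : Fin k) → 0)) v ≡ x
  first-row = begin
    1 * x + dot (tabulate (λ _ → 0)) v ≡⟨ cong (1 * x +_) (dot-zeroˡ v) ⟩
    1 * x + 0                          ≡⟨ +-identityʳ (1 * x) ⟩
    1 * x                              ≡⟨ *-identityˡ x ⟩
    x                                  ∎
  -- Row i+1 of identity (suc k) unfolds to 0 ∷ (row i of identity k).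
  other-rows : map (λ row → dot row (x ∷ v)) (tail (identity (suc k))) ≡ v
  other-rows = begin
    map (λ row → dot row (x ∷ v)) (tail (identity (suc k))) ≡⟨ tabulate-∘ _ _ ⟨
    tabulate _                                              ≡⟨ tabulate-∘ (λ row → dot row v) _ ⟩
    identity k ·v v                                          ≡⟨ identity-·v v ⟩
    v                                                        ∎

zipWith-·v-identity : ∀ {k n} {g : Fin n → Matrix k} → (∀ i → g i ≡ identity k) →
                      (vs : Vec (Vec ℕ k) n) → zipWith _·v_ (tabulate g) vs ≡ vs
zipWith-·v-identity g≡I []       = refl
zipWith-·v-identity g≡I (v ∷ vs) =
  cong₂ _∷_ (trans (cong (_·v v) (g≡I Fin.zero)) (identity-·v v))
            (zipWith-·v-identity (λ i → g≡I (Fin.suc i)) vs)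

head-+v : ∀ {k} (u w : Vec ℕ (suc k)) → head (u +v w) ≡ head u + head w
head-+v (_ ∷ _) (_ ∷ _) = refl

module _ {Σ : Signature} {k : ℕ} (A : MatrixInterpretation {Σ} (suc k)) where
  open MatrixInterpretation A

  firstComponent : SLI {Σ}
  firstComponent f = head (const f)

  module _ (strong : StronglyLinearMI A) (α : Var Σ → Vec ℕ (suc k)) where

    private
      c : SLI {Σ}
      c = firstComponent
      β : Var Σ → ℕ
      β x = head (α x)

      sum+v : ∀ {n} → Vec ℕ (suc k) → Vec (Vec ℕ (suc k)) n → Vec ℕ (suc k)
      sum+v = foldr (λ _ → Vec ℕ (suc k)) _+v_

    mutual
      head-evalMI : (t : Term Σ) → head (evalMI A α t) ≡ evalSLI c β t
      head-evalMI (var x)    = refl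
      head-evalMI (fun f ts) = begin
        head (sum+v (const f) (zipWith _·v_ (tabulate (mat f)) (evalMIs A α ts)))
          ≡⟨ cong (λ vs → head (sum+v (const f) vs)) (zipWith-·v-identity (strong f) (evalMIs A α ts)) ⟩
        head (sum+v (const f) (evalMIs A α ts))
          ≡⟨ head-sum-evalMIs (const f) ts ⟩
        sumArgs c β ts + c f
          ∎

      head-sum-evalMIs : ∀ {n} (u : Vec ℕ (suc k)) (ts : Vec (Term Σ) n) →
                         head (sum+v u (evalMIs A α ts)) ≡ sumArgs c β ts + head u
      head-sum-evalMIs u []       = refl
      head-sum-evalMIs u (t ∷ ts) = begin
        head (evalMI A α t +v sum+v u (evalMIs A α ts))
          ≡⟨ head-+v (evalMI A α t) _ ⟩
        head (evalMI A α t) + head (sum+v u (evalMIs A α ts))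
          ≡⟨ cong₂ _+_ (head-evalMI t) (head-sum-evalMIs u ts) ⟩
        evalSLI c β t + (sumArgs c β ts + head u)
          ≡⟨ +-assoc (evalSLI c β t) _ _ ⟨
        sumArgs c β (t ∷ ts) + head u
          ∎

lemma47 : (Σ : Signature) (S : TRS Σ) →
    (∃ λ (k : ℕ) → ∃ λ (A : MatrixInterpretation {Σ} (suc k)) → StronglyLinearMI A × CompatibleMI S A) →
    ∃ λ (B : SLI {Σ}) → CompatibleSLI S B
lemma47 Σ S (k , A , strong , compatible) = firstComponent A , compatibleSLI
  where
  compatibleSLI : CompatibleSLI S (firstComponent A)
  compatibleSLI {l} {r} rule β =
    subst₂ _>_ (head-evalMI A strong α l) (head-evalMI A strong α r)
               (proj₁ (compatible rule α))
    where
    α : Var Σ → Vec ℕ (suc k)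
    α x = β x ∷ replicate k 0
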